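{- Let $\varphi$ be a $\mathbf{K}^{Horn,\Box}$-formula. Then $\varphi$ is satisfiable if and only if it is satisfiable in a pre-linear model.
   Context: Fix a countable set $\mathcal P$ of propositional letters; Kripke models $M=((W,R),V)$ with $R\subseteq W\times W$ arbitrary, $V:W\to2^{\mathcal P}$, and standard modal satisfaction; $\varphi$ is satisfiable if $M,w\models\varphi$ for some model $M$ and world $w$. Box positive literals: $\lambda::=\top\mid p\mid\Box\lambda$. A $\mathbf{K}^{Horn,\Box}$-formula is a finite conjunction of clauses $\Box^s(\neg\lambda_1\vee\dots\vee\neg\lambda_n\vee\lambda_{n+1}\vee\dots\vee\lambda_{n+m})$ with $s,n\ge0$, $m\le1$, $\lambda_i$ box positive literals ($\bot:=\neg\top$). A frame $(W,R)$ is pre-linear if there is a unique world $w_0$ (the root) such that $w_0R^*w$ for every $w\in W$ ($R^*$ the reflexive-transitive closure of $R$), and every world has at most one $R$-successor; a pre-linear model is a model on a pre-linear frame. -}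

module Defs where

open import Data.Nat using (ℕ; zero; suc)
open import Data.Bool using (Bool; true)
open import Data.List using (List; []; _∷_; map; _++_)
open import Data.Maybe using (Maybe; nothing; just)
open import Data.Product using (Σ; ∃; _×_; _,_)
open import Data.Sum using (_⊎_)
open import Data.Unit using (⊤; tt)
open import Data.Empty using (⊥)
open import Relation.Nullary using (¬_)
open import Relation.Binary.PropositionalEquality using (_≡_)
open import Relation.Binary.Construct.Closure.ReflexiveTransitive using (Star)

Prop : Set
Prop = ℕ

data Fm : Set where
  ⊤ᶠ  : Fm
  var : Prop → Fm
  ¬ᶠ_ : Fm → Fm
  _∧ᶠ_ : Fm → Fm → Fm
  _∨ᶠ_ : Fm → Fm → Fm
  □_  : Fm → Fm

⊥ᶠ : Fm
⊥ᶠ = ¬ᶠ ⊤ᶠ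

□^ : ℕ → Fm → Fm
□^ zero    φ = φ
□^ (suc s) φ = □ (□^ s φ)

record Frame : Set₁ where
  field
    W : Set
    R : W → W → Set

record Model : Set₁ where
  field
    frame : Frame
  open Frame frame public
  field
    V : W → Prop → Bool

_,_⊨_ : (M : Model) → Model.W M → Fm → Set
M , w ⊨ ⊤ᶠ      = ⊤
M , w ⊨ var p   = Model.V M w p ≡ true
M , w ⊨ (¬ᶠ φ)  = ¬ (M , w ⊨ φ)
M , w ⊨ (φ ∧ᶠ ψ) = (M , w ⊨ φ) × (M , w ⊨ ψ)
M , w ⊨ (φ ∨ᶠ ψ) = (M , w ⊨ φ) ⊎ (M , w ⊨ ψ)
M , w ⊨ (□ φ)   = ∀ v → Model.R M w v → M , v ⊨ φ

Satisfiable : Fm → Set₁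
Satisfiable φ = Σ Model λ M → Σ (Model.W M) λ w → M , w ⊨ φ

IsRoot : (F : Frame) → Frame.W F → Set
IsRoot F w₀ = ∀ w → Star (Frame.R F) w₀ w

PreLinear : Frame → Set
PreLinear F =
  (Σ (Frame.W F) λ w₀ → IsRoot F w₀ × (∀ w₁ → IsRoot F w₁ → w₁ ≡ w₀))
  × (∀ w v v′ → Frame.R F w v → Frame.R F w v′ → v ≡ v′)

SatisfiablePreLinear : Fm → Set₁
SatisfiablePreLinear φ =
  Σ Model λ M → PreLinear (Model.frame M) × Σ (Model.W M) λ w → M , w ⊨ φ

data BoxLit : Set where
  top : BoxLit
  lit : Prop → BoxLit
  box : BoxLit → BoxLit

⌜_⌝ : BoxLit → Fm
⌜ top ⌝   = ⊤ᶠ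
⌜ lit p ⌝ = var p
⌜ box l ⌝ = □ ⌜ l ⌝

⋁ : List Fm → Fm
⋁ []           = ⊥ᶠ
⋁ (φ ∷ [])     = φ
⋁ (φ ∷ ψ ∷ φs) = φ ∨ᶠ ⋁ (ψ ∷ φs)

⋀ : List Fm → Fm
⋀ []           = ⊤ᶠ
⋀ (φ ∷ [])     = φ
⋀ (φ ∷ ψ ∷ φs) = φ ∧ᶠ ⋀ (ψ ∷ φs)

record HornClause : Set where
  constructor clause
  field
    depth : ℕ
    negs  : List BoxLit
    pos   : Maybe BoxLit

maybeToList : Maybe BoxLit → List Fm
maybeToList nothing  = []
maybeToList (just l) = ⌜ l ⌝ ∷ []

clauseFm : HornClause → Fm
clauseFm (clause s ns p) =
  □^ s (⋁ (map (λ l → ¬ᶠ ⌜ l ⌝) ns ++ maybeToList p))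

HornFormula : Set
HornFormula = List HornClause

hornFm : HornFormula → Fm
hornFm cs = ⋀ (map clauseFm cs)

-- Given M, w ⊨ φ, forward chaining over the clauses of φ derives a finite set F of facts
-- "no world lies at depth k below w" and "p holds at every world of depth k", all true in M,
-- and closed: every clause whose body F derives has its head recorded in F. Box positive
-- literals only speak about whole depths, so the chain 0 → 1 → 2 → … of depths that F does
-- not declare empty, with p true at k iff F contains "p at depth k", satisfies exactly the
-- literals F derives; hence each clause of φ either fails in its body or fired and has its
-- head true there.

module Submission where

open import Defs
open import Data.Bool.Properties using (T-≡)
open import Data.Empty using (⊥; ⊥-elim)
import Data.Empty.Irrelevant as Irrelevant
open import Data.List using (List; []; _∷_; map; _++_; length)
open import Data.List.Membership.Propositional using (_∈_; lose)
open import Data.List.Membership.Propositional.Properties using (∈-map⁺; ∈-++⁺ˡ; ∈-++⁺ʳ)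
open import Data.List.Properties using (length-removeAt′)
open import Data.List.Relation.Unary.All as All using (All; []; _∷_; all?)
open import Data.List.Relation.Unary.All.Properties using (¬All⇒Any¬)
  renaming (++⁺ to All-++⁺; map⁺ to All-map⁺)
open import Data.List.Relation.Unary.Any as Any using (Any; here; there; any?; _─_)
open import Data.List.Relation.Unary.Any.Properties using (lookup-result; singleton⁻; ¬Any[])
import Data.List.Relation.Unary.Any.Properties as Any
open import Data.Maybe using (Maybe; nothing; just)
open import Data.Nat using (ℕ; zero; suc; _+_; _≤_; _<_; _≤?_; s≤s)
open import Data.Nat.Induction using (<-wellFounded)
open import Data.Nat.Properties using (≤-refl; ≤-reflexive; ≤-trans; m≤n⇒m≤1+n; n≤1+n; +-suc; +-identityʳ)
import Data.Nat.Properties as ℕ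
open import Data.Product using (∃-syntax; _×_; _,_; uncurry)
import Data.Product as Product
open import Data.Sum using (_⊎_; inj₁; inj₂)
import Data.Sum as Sum
open import Data.Unit using (⊤; tt)
open import Function using (_∘_; id)
open import Function.Bundles using (_⇔_; mk⇔; Equivalence)
open import Induction.WellFounded using (Acc; acc)
open import Relation.Binary.Construct.Closure.ReflexiveTransitive using (Star; ε; _◅_; _◅◅_)
open import Relation.Binary.Definitions using (DecidableEquality)
open import Relation.Binary.PropositionalEquality using (_≡_; refl; sym; trans; cong; cong₂)
open import Relation.Nullary using (¬_; Dec; yes; no)
open import Relation.Nullary.Decidable using (isYes; toWitness; fromWitness; map′; _×-dec_; _⊎-dec_)

open Equivalence using (to; from)

¬⌜_⌝ : BoxLit → Fm
¬⌜ l ⌝ = ¬ᶠ ⌜ l ⌝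

clauseBody : List BoxLit → Maybe BoxLit → Fm
clauseBody ns p = ⋁ (map ¬⌜_⌝ ns ++ maybeToList p)

module _ (M : Model) where
  open Model M

  Reach : ℕ → W → W → Set
  Reach zero    u v = u ≡ v
  Reach (suc n) u v = ∃[ x ] R u x × Reach n x v

  Reach-snoc : ∀ n {u v x} → Reach n u v → R v x → Reach (suc n) u x
  Reach-snoc zero    refl        r′ = _ , r′ , refl
  Reach-snoc (suc n) (x , r , π) r′ = x , r , Reach-snoc n π r′

  Reach-unsnoc : ∀ n {u x} → Reach (suc n) u x → ∃[ v ] Reach n u v × R v x
  Reach-unsnoc zero    (x , r , refl) = _ , refl , r
  Reach-unsnoc (suc n) (x , r , π) with v , π′ , r′ ← Reach-unsnoc n π = v , (x , r , π′) , r′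

  Reach-prefix : ∀ {m n u v} → m ≤ n → Reach n u v → ∃[ v′ ] Reach m u v′
  Reach-prefix {zero}  _         _           = _ , refl
  Reach-prefix {suc m} (s≤s m≤n) (x , r , π) with v′ , π′ ← Reach-prefix m≤n π = v′ , x , r , π′

  ⊨□^ : ∀ s ψ {u} → M , u ⊨ □^ s ψ ⇔ (∀ {v} → Reach s u v → M , v ⊨ ψ)
  ⊨□^ zero    ψ = mk⇔ (λ { h refl → h }) (λ h → h refl)
  ⊨□^ (suc s) ψ = mk⇔ (λ { h (x , r , π) → to (⊨□^ s ψ) (h x r) π })
                      (λ h x r → from (⊨□^ s ψ) (λ π → h (x , r , π)))

  ⊨⋁ : ∀ φs {u} → M , u ⊨ ⋁ φs ⇔ Any (M , u ⊨_) φs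
  ⊨⋁ []           = mk⇔ (λ h → ⊥-elim (h tt)) (λ ())
  ⊨⋁ (φ ∷ [])     = mk⇔ here singleton⁻
  ⊨⋁ (φ ∷ ψ ∷ φs) = mk⇔ (Any.fromSum ∘ Sum.map₂ (to (⊨⋁ (ψ ∷ φs))))
                        (Sum.map₂ (from (⊨⋁ (ψ ∷ φs))) ∘ Any.toSum)

  ⊨⋀ : ∀ φs {u} → M , u ⊨ ⋀ φs ⇔ All (M , u ⊨_) φs
  ⊨⋀ []           = mk⇔ (λ _ → []) (λ _ → tt)
  ⊨⋀ (φ ∷ [])     = mk⇔ (_∷ []) All.head
  ⊨⋀ (φ ∷ ψ ∷ φs) = mk⇔ (uncurry _∷_ ∘ Product.map₂ (to (⊨⋀ (ψ ∷ φs))))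
                        (Product.map₂ (from (⊨⋀ (ψ ∷ φs))) ∘ All.uncons)

  ⊨clauseBody : ∀ ns p {u} →
    M , u ⊨ clauseBody ns p ⇔ (Any (λ l → ¬ M , u ⊨ ⌜ l ⌝) ns ⊎ Any (M , u ⊨_) (maybeToList p))
  ⊨clauseBody ns p = mk⇔
    (Sum.map₁ Any.map⁻ ∘ Any.++⁻ (map ¬⌜_⌝ ns) ∘ to (⊨⋁ (map ¬⌜_⌝ ns ++ maybeToList p)))
    (from (⊨⋁ (map ¬⌜_⌝ ns ++ maybeToList p)) ∘ Sum.[ Any.++⁺ˡ ∘ Any.map⁺ , Any.++⁺ʳ (map ¬⌜_⌝ ns) ])

data Fact : Set where
  empty : ℕ → Fact
  atom  : Prop → ℕ → Fact

_≟ᶠ_ : DecidableEquality Fact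
empty j  ≟ᶠ empty k  = map′ (cong empty) (λ { refl → refl }) (j ℕ.≟ k)
atom p j ≟ᶠ atom q k = map′ (uncurry (cong₂ atom)) (λ { refl → refl , refl }) (p ℕ.≟ q ×-dec j ℕ.≟ k)
empty _  ≟ᶠ atom _ _ = no λ ()
atom _ _ ≟ᶠ empty _  = no λ ()

open import Data.List.Membership.DecPropositional _≟ᶠ_ using (_∈?_)

litFacts : BoxLit → ℕ → List Fact
litFacts top     k = []
litFacts (lit p) k = atom p k ∷ []
litFacts (box l) k = litFacts l (suc k)

headFacts : HornClause → List Fact
headFacts (clause s _ nothing)  = empty s ∷ []
headFacts (clause s _ (just l)) = litFacts l s

Voids : Fact → ℕ → Set
Voids (empty j)  k = j ≤ k
Voids (atom _ _) k = ⊥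

Empty : List Fact → ℕ → Set
Empty F k = Any (λ f → Voids f k) F

_⊢_at_ : List Fact → BoxLit → ℕ → Set
F ⊢ top   at k = ⊤
F ⊢ lit p at k = atom p k ∈ F
F ⊢ box l at k = Empty F (suc k) ⊎ F ⊢ l at suc k

litFacts-⊢ : ∀ {F} l k → All (_∈ F) (litFacts l k) → F ⊢ l at k
litFacts-⊢ top     k []           = tt
litFacts-⊢ (lit p) k (a∈F ∷ [])   = a∈F
litFacts-⊢ (box l) k ⊢l           = inj₂ (litFacts-⊢ l (suc k) ⊢l)

Fires : List Fact → HornClause → Set
Fires F (clause s ns _) = All (λ l → F ⊢ l at s) ns

Closed : HornFormula → List Fact → Set
Closed φ F = ∀ {c} → c ∈ φ → ¬ Fires F c ⊎ All (_∈ F) (headFacts c)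

Empty? : ∀ F k → Dec (Empty F k)
Empty? F k = any? voids? F
  where
  voids? : ∀ f → Dec (Voids f k)
  voids? (empty j)  = j ≤? k
  voids? (atom _ _) = no id

_⊢?_at_ : ∀ F l k → Dec (F ⊢ l at k)
F ⊢? top   at k = yes tt
F ⊢? lit p at k = atom p k ∈? F
F ⊢? box l at k = Empty? F (suc k) ⊎-dec F ⊢? l at suc k

Fires? : ∀ F c → Dec (Fires F c)
Fires? F (clause s ns _) = all? (λ l → F ⊢? l at s) ns

module _ {A : Set} {P : A → Set} where

  ─-⊆ : ∀ {xs y} (i : Any P xs) → y ∈ (xs ─ i) → y ∈ xs
  ─-⊆ (here _)  y∈          = there y∈
  ─-⊆ (there i) (here refl) = here refl
  ─-⊆ (there i) (there y∈)  = there (─-⊆ i y∈)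

  ∈-─ : ∀ {xs y} (i : Any P xs) → y ∈ xs → y ≡ Any.lookup i ⊎ y ∈ (xs ─ i)
  ∈-─ (here _)  (here refl) = inj₁ refl
  ∈-─ (here _)  (there y∈)  = inj₂ y∈
  ∈-─ (there i) (here refl) = inj₂ (here refl)
  ∈-─ (there i) (there y∈)  = Sum.map₂ there (∈-─ i y∈)

  lookup-∈ : ∀ {xs} (i : Any P xs) → Any.lookup i ∈ xs
  lookup-∈ (here _)  = here refl
  lookup-∈ (there i) = there (lookup-∈ i)

module Saturation (P : Fact → Set) (φ : HornFormula)
  (fire-preserves : ∀ {c F} → c ∈ φ → All P F → Fires F c → All P (headFacts c)) where

  Pending : List HornClause → List Fact → Set
  Pending U F = ∀ {c} → c ∈ φ → c ∈ U ⊎ All (_∈ F) (headFacts c)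

  chase : ∀ U F → Acc _<_ (length U) → (∀ {c} → c ∈ U → c ∈ φ) → All P F → Pending U F →
          ∃[ F′ ] All P F′ × Closed φ F′
  chase U F (acc rec) U⊆φ PF pending with any? (Fires? F) U
  ... | no none = F , PF , Sum.map₁ (λ c∈U fires → none (lose c∈U fires)) ∘ pending
  ... | yes i   = chase (U ─ i) (headFacts c ++ F) (rec shrinks) (U⊆φ ∘ ─-⊆ i)
                    (All-++⁺ (fire-preserves (U⊆φ (lookup-∈ i)) PF (lookup-result i)) PF) pending′
    where
    c : HornClause
    c = Any.lookup i

    shrinks : length (U ─ i) < length U
    shrinks = ≤-reflexive (sym (length-removeAt′ U (Any.index i)))

    pending′ : Pending (U ─ i) (headFacts c ++ F)
    pending′ d∈φ with pending d∈φ
    ... | inj₂ fired = inj₂ (All.map (∈-++⁺ʳ (headFacts c)) fired)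
    ... | inj₁ d∈U with ∈-─ i d∈U
    ...   | inj₁ refl = inj₂ (All.tabulate ∈-++⁺ˡ)
    ...   | inj₂ d∈U′ = inj₁ d∈U′

saturate : ∀ {P : Fact → Set} {φ} →
           (∀ {c F} → c ∈ φ → All P F → Fires F c → All P (headFacts c)) →
           ∃[ F ] All P F × Closed φ F
saturate {P} {φ} fire-preserves = chase φ [] (<-wellFounded (length φ)) id [] inj₁
  where open Saturation P φ fire-preserves

module Soundness (M : Model) (w : Model.W M) where
  open Model M

  AtDepth : ℕ → Fm → Set
  AtDepth k ψ = ∀ {u} → Reach M k w u → M , u ⊨ ψ

  Holds : Fact → Set
  Holds (empty k)  = ∀ {u} → ¬ Reach M k w u
  Holds (atom p k) = AtDepth k (var p)

  litFacts-sound : ∀ l k → AtDepth k ⌜ l ⌝ → All Holds (litFacts l k)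
  litFacts-sound top     k h = []
  litFacts-sound (lit p) k h = h ∷ []
  litFacts-sound (box l) k h = litFacts-sound l (suc k) λ π →
    let _ , π′ , r = Reach-unsnoc M k π in h π′ _ r

  Empty-sound : ∀ {F k} → All Holds F → Empty F k → ∀ {u} → ¬ Reach M k w u
  Empty-sound H e π = All.lookupWith voids H e
    where
    voids : ∀ {f} → Holds f → Voids f _ → ⊥
    voids {empty j} h j≤k = let _ , π′ = Reach-prefix M j≤k π in h π′

  ⊢-sound : ∀ {F} → All Holds F → ∀ l k → F ⊢ l at k → AtDepth k ⌜ l ⌝
  ⊢-sound H top     k _         π     = tt
  ⊢-sound H (lit a) k a∈F       π     = All.lookup H a∈F π
  ⊢-sound H (box l) k (inj₁ e)  π _ r = ⊥-elim (Empty-sound H e (Reach-snoc M k π r))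
  ⊢-sound H (box l) k (inj₂ ⊢l) π _ r = ⊢-sound H l (suc k) ⊢l (Reach-snoc M k π r)

  module _ {φ : HornFormula} (w⊨φ : M , w ⊨ hornFm φ) where

    head-forced : ∀ {F s ns p} → All Holds F → clause s ns p ∈ φ → Fires F (clause s ns p) →
                  ∀ {u} → Reach M s w u → Any (M , u ⊨_) (maybeToList p)
    head-forced {s = s} {ns} {p} H c∈φ fires {u} π with to (⊨clauseBody M ns p) body
      where
      body : M , u ⊨ clauseBody ns p
      body = to (⊨□^ M s _) (All.lookup (to (⊨⋀ M _) w⊨φ) (∈-map⁺ clauseFm c∈φ)) π
    ... | inj₁ refuted = ⊥-elim (All.lookupWith (λ l ¬l → ¬l l) premises refuted)
      where
      premises : All (λ l → M , u ⊨ ⌜ l ⌝) ns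
      premises = All.map (λ {l} ⊢l → ⊢-sound H l s ⊢l π) fires
    ... | inj₂ head    = head

    fire-sound : ∀ {c F} → c ∈ φ → All Holds F → Fires F c → All Holds (headFacts c)
    fire-sound {clause s ns nothing}  c∈φ H fires = (¬Any[] ∘ head-forced H c∈φ fires) ∷ []
    fire-sound {clause s ns (just l)} c∈φ H fires =
      litFacts-sound l s (singleton⁻ ∘ head-forced H c∈φ fires)

-- The irrelevant field makes worlds of equal depth definitionally equal, which gives
-- pre-linearity.
record Level (F : List Fact) : Set where
  constructor level
  field
    depth      : ℕ
    .inhabited : ¬ Empty F depth

open Level

chain : List Fact → Model
chain F = record
  { frame = record { W = Level F ; R = λ u v → depth v ≡ suc (depth u) }
  ; V     = λ u p → isYes (atom p (depth u) ∈? F)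
  }

module Chain (F : List Fact) where

  Empty-suc : ∀ {k} → Empty F k → Empty F (suc k)
  Empty-suc = Any.map λ { {empty j} j≤k → m≤n⇒m≤1+n j≤k }

  chain-⊨ : ∀ l (u : Level F) → chain F , u ⊨ ⌜ l ⌝ ⇔ F ⊢ l at depth u
  chain-⊨ top     u = mk⇔ id id
  chain-⊨ (lit p) u = mk⇔ (toWitness ∘ from T-≡) (to T-≡ ∘ fromWitness)
  chain-⊨ (box l) u = mk⇔ forward backward
    where
    forward : chain F , u ⊨ (□ ⌜ l ⌝) → F ⊢ box l at depth u
    forward h with Empty? F (suc (depth u))
    ... | yes e = inj₁ e
    ... | no ¬e = inj₂ (to (chain-⊨ l (level _ ¬e)) (h (level _ ¬e) refl))
    backward : F ⊢ box l at depth u → chain F , u ⊨ (□ ⌜ l ⌝)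
    backward (inj₁ e)  (level _ ¬e) refl = Irrelevant.⊥-elim (¬e e)
    backward (inj₂ ⊢l) v            refl = from (chain-⊨ l v) ⊢l

  Reach-depth : ∀ n {u v} → Reach (chain F) n u v → depth v ≡ n + depth u
  Reach-depth zero    refl           = refl
  Reach-depth (suc n) (_ , refl , π) = trans (Reach-depth n π) (+-suc n _)

  Star-depth : ∀ {u v} → Star (Model.R (chain F)) u v → depth u ≤ depth v
  Star-depth ε          = ≤-refl
  Star-depth (refl ◅ π) = ≤-trans (n≤1+n _) (Star-depth π)

  module Rooted (root-inhabited : ¬ Empty F 0) where

    root : Level F
    root = level 0 root-inhabited

    root-reaches : ∀ k .(ne : ¬ Empty F k) → Star (Model.R (chain F)) root (level k ne)
    root-reaches zero    ne = ε
    root-reaches (suc k) ne = root-reaches k (ne ∘ Empty-suc) ◅◅ (refl ◅ ε)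

    chain-preLinear : PreLinear (Model.frame (chain F))
    chain-preLinear = (root , (λ { (level k ne) → root-reaches k ne }) , unique-root) , unique-successor
      where
      unique-root : ∀ u → IsRoot (Model.frame (chain F)) u → u ≡ root
      unique-root (level zero    _) _      = refl
      unique-root (level (suc k) _) u-root with () ← Star-depth (u-root root)
      unique-successor : ∀ u v v′ → depth v ≡ suc (depth u) → depth v′ ≡ suc (depth u) → v ≡ v′
      unique-successor u (level _ _) (level _ _) refl refl = refl

    module _ {φ : HornFormula} (closed : Closed φ F) where

      chain-⊨body : ∀ {s ns p} → clause s ns p ∈ φ → ∀ .ne →
                    chain F , level s ne ⊨ clauseBody ns p
      chain-⊨body {s} {ns} {p} c∈φ ne with closed c∈φ
      ... | inj₁ ¬fires =
        from (⊨clauseBody (chain F) ns p) (inj₁ (Any.map refute (¬All⇒Any¬ (λ l → F ⊢? l at s) ns ¬fires)))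
        where
        refute : ∀ {l} → ¬ F ⊢ l at s → ¬ chain F , level s ne ⊨ ⌜ l ⌝
        refute {l} ¬⊢l = ¬⊢l ∘ to (chain-⊨ l _)
      chain-⊨body {s} {p = nothing} c∈φ ne | inj₂ (empty∈F ∷ []) =
        Irrelevant.⊥-elim (ne (lose empty∈F ≤-refl))
      chain-⊨body {s} {ns} {just l} c∈φ ne | inj₂ heads =
        from (⊨clauseBody (chain F) ns (just l))
             (inj₂ (here (from (chain-⊨ l _) (litFacts-⊢ l s heads))))

      chain-⊨clause : ∀ {c} → c ∈ φ → chain F , root ⊨ clauseFm c
      chain-⊨clause {clause s ns p} c∈φ = from (⊨□^ (chain F) s _) body
        where
        body : ∀ {u} → Reach (chain F) s root u → chain F , u ⊨ clauseBody ns p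
        body {level k ne} π with trans (Reach-depth s π) (+-identityʳ s)
        ... | refl = chain-⊨body c∈φ ne

      chain-⊨hornFm : chain F , root ⊨ hornFm φ
      chain-⊨hornFm = from (⊨⋀ (chain F) _) (All-map⁺ (All.tabulate chain-⊨clause))

lemma4p1 : (φ : HornFormula) → Satisfiable (hornFm φ) ⇔ SatisfiablePreLinear (hornFm φ)
lemma4p1 φ = mk⇔ preLinearise (λ (M , _ , w , w⊨φ) → M , w , w⊨φ)
  where
  preLinearise : Satisfiable (hornFm φ) → SatisfiablePreLinear (hornFm φ)
  preLinearise (M , w , w⊨φ) with F , sound , closed ← saturate (Soundness.fire-sound M w {φ} w⊨φ) =
    chain F , chain-preLinear , root , chain-⊨hornFm closed
    where
    open Chain.Rooted F (λ e → Soundness.Empty-sound M w sound e refl)
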